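{- Let $n \geq 1$ and $m \geq 1$ be integers, let $F_j$ denote the $j$th Fibonacci number ($F_0=0$, $F_1=1$), and let $1 \leq k_1, \ldots, k_m, k'_1, \ldots, k'_m \leq n$. Then \[ \sum_{i=1}^m F_{2k_i-1} \equiv \sum_{i=1}^m F_{2k'_i-1} \pmod{F_{2n}} \iff \sum_{i=1}^m F_{2n-2k_i+1} \equiv \sum_{i=1}^m F_{2n-2k'_i+1} \pmod{F_{2n}}. \] -}

module Defs where

open import Data.Nat using (ℕ; zero; suc; _+_)
open import Data.Fin using (Fin)
import Data.Fin as Fin
open import Data.Integer using (ℤ; +_; _-_)
open import Data.Integer.Divisibility using (_∣_)

F : ℕ → ℕ
F zero = zero
F (suc zero) = suc zero
F (suc (suc n)) = F (suc n) + F n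

Σ : (m : ℕ) → (Fin m → ℕ) → ℕ
Σ zero f = zero
Σ (suc m) f = f Fin.zero + Σ m (λ i → f (Fin.suc i))

_≡_[mod_] : ℕ → ℕ → ℕ → Set
a ≡ b [mod c ] = (+ c) ∣ ((+ a) - (+ b))

{-# OPTIONS --safe #-}
module Submission where

-- Write N = F (2n) and c = F (2n − 1).  d'Ocagne's identity at an even shift gives
-- c · F (2k − 1) ≡ F (2n − 2k + 1) (mod N) for 1 ≤ k ≤ n, so multiplication by c carries
-- each side of the first congruence to the corresponding side of the second.  The case
-- k = n is Cassini's identity c² ≡ 1 (mod N): c is invertible, so the implication reverses.

open import Defs
open import Data.Nat using (ℕ; _≤_; _*_; _∸_; _+_)
open import Data.Fin using (Fin)
open import Data.Product using (_×_)
open import Function.Bundles using (_⇔_)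

open import Data.Nat using (zero; suc; s≤s; z≤n)
open import Data.Nat.Properties
  using (*-zeroʳ; *-identityˡ; *-assoc; *-comm; *-distribˡ-+; +-comm; m+n∸m≡n; n∸n≡0; ≤-refl; m≤n⇒∃[o]m+o≡n)
import Data.Nat.Solver as ℕ
open import Data.Integer using (+_; 0ℤ; 1ℤ; -1ℤ; -_; _^_)
  renaming (_+_ to _⊕_; _*_ to _⊛_; _-_ to _⊖_)
open import Data.Integer.Properties using (pos-+; pos-*; ^-*-assoc; ^-zeroˡ)
import Data.Integer.Properties as ℤ
open import Data.Integer.Divisibility.Signed as Signed using (divides; ∣ᵤ⇒∣; ∣⇒∣ᵤ)
open import Data.Integer.Solver using (module +-*-Solver)
open import Data.Fin using (zero; suc)
open import Data.Product using (_,_; proj₁; proj₂)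
open import Function.Base using (_∘_)
open import Function.Bundles using (mk⇔)
open import Level using (0ℓ)
open import Relation.Binary.Bundles using (Setoid)
open import Relation.Binary.Structures using (IsEquivalence)
open import Relation.Binary.PropositionalEquality
  using (_≡_; refl; sym; trans; cong; cong₂; subst; module ≡-Reasoning)
import Relation.Binary.Reasoning.Setoid as SetoidReasoning

module _ {N : ℕ} where

  -- a ≡ b [mod N ] only constrains ∣ + a - + b ∣, from which Agda cannot infer a and b;
  -- hence the explicit naturals here and at the use sites of the lemmas below.
  private
    mod⇒∣ : ∀ a b → a ≡ b [mod N ] → + N Signed.∣ (+ a ⊖ + b)
    mod⇒∣ a b = ∣ᵤ⇒∣

    ∣⇒mod : ∀ a b {d} → + a ⊖ + b ≡ d → + N Signed.∣ d → a ≡ b [mod N ]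
    ∣⇒mod a b refl = ∣⇒∣ᵤ

  ≡-mod-refl : ∀ {a} → a ≡ a [mod N ]
  ≡-mod-refl {a} = ∣⇒mod a a (solve 1 (λ x → x :- x := con 0ℤ) refl (+ a)) (divides 0ℤ refl)
    where open +-*-Solver

  ≡-mod-sym : ∀ {a b} → a ≡ b [mod N ] → b ≡ a [mod N ]
  ≡-mod-sym {a} {b} a≡b = ∣⇒mod b a (solve 2 (λ x y → y :- x := :- (x :- y)) refl (+ a) (+ b))
    (Signed.∣m⇒∣-m (mod⇒∣ a b a≡b))
    where open +-*-Solver

  ≡-mod-trans : ∀ {a b c} → a ≡ b [mod N ] → b ≡ c [mod N ] → a ≡ c [mod N ]
  ≡-mod-trans {a} {b} {c} a≡b b≡c = ∣⇒mod a c
    (solve 3 (λ x y z → x :- z := (x :- y) :+ (y :- z)) refl (+ a) (+ b) (+ c))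
    (Signed.∣m∣n⇒∣m+n (mod⇒∣ a b a≡b) (mod⇒∣ b c b≡c))
    where open +-*-Solver

  ≡-mod-reflexive : ∀ {a b} → a ≡ b → a ≡ b [mod N ]
  ≡-mod-reflexive {a} refl = ≡-mod-refl {a}

  +-cong-mod : ∀ {a b c d} → a ≡ b [mod N ] → c ≡ d [mod N ] → (a + c) ≡ (b + d) [mod N ]
  +-cong-mod {a} {b} {c} {d} a≡b c≡d = ∣⇒mod (a + c) (b + d)
    (begin
      + (a + c) ⊖ + (b + d)       ≡⟨ cong₂ _⊖_ (pos-+ a c) (pos-+ b d) ⟩
      (+ a ⊕ + c) ⊖ (+ b ⊕ + d)   ≡⟨ solve 4 (λ x y z w → (x :+ z) :- (y :+ w) := (x :- y) :+ (z :- w))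
                                       refl (+ a) (+ b) (+ c) (+ d) ⟩
      (+ a ⊖ + b) ⊕ (+ c ⊖ + d)   ∎)
    (Signed.∣m∣n⇒∣m+n (mod⇒∣ a b a≡b) (mod⇒∣ c d c≡d))
    where open ≡-Reasoning
          open +-*-Solver

  *-congˡ-mod : ∀ c {a b} → a ≡ b [mod N ] → (c * a) ≡ (c * b) [mod N ]
  *-congˡ-mod c {a} {b} a≡b = ∣⇒mod (c * a) (c * b)
    (begin
      + (c * a) ⊖ + (c * b)       ≡⟨ cong₂ _⊖_ (pos-* c a) (pos-* c b) ⟩
      + c ⊛ + a ⊖ + c ⊛ + b       ≡⟨ solve 3 (λ z x y → z :* x :- z :* y := z :* (x :- y))
                                       refl (+ c) (+ a) (+ b) ⟩
      + c ⊛ (+ a ⊖ + b)           ∎)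
    (Signed.∣n⇒∣m*n (+ c) (mod⇒∣ a b a≡b))
    where open ≡-Reasoning
          open +-*-Solver

  *-congʳ-mod : ∀ c {a b} → a ≡ b [mod N ] → (a * c) ≡ (b * c) [mod N ]
  *-congʳ-mod c {a} {b} rewrite *-comm a c | *-comm b c = *-congˡ-mod c

  ≡-mod-isEquivalence : IsEquivalence (λ a b → a ≡ b [mod N ])
  ≡-mod-isEquivalence = record
    { refl  = λ {a} → ≡-mod-refl {a}
    ; sym   = λ {a b} → ≡-mod-sym {a} {b}
    ; trans = λ {a b c} → ≡-mod-trans {a} {b} {c}
    }

≡-mod-setoid : ℕ → Setoid 0ℓ 0ℓ
≡-mod-setoid N = record { isEquivalence = ≡-mod-isEquivalence {N} }

*-cancelˡ-mod : ∀ {N c d a b} → (d * c) ≡ 1 [mod N ] →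
                (c * a) ≡ (c * b) [mod N ] → a ≡ b [mod N ]
*-cancelˡ-mod {N} {c} {d} {a} {b} dc≡1 ca≡cb = begin
  a             ≡⟨ *-identityˡ a ⟨
  1 * a         ≈⟨ *-congʳ-mod a {d * c} {1} dc≡1 ⟨
  d * c * a     ≡⟨ *-assoc d c a ⟩
  d * (c * a)   ≈⟨ *-congˡ-mod d {c * a} {c * b} ca≡cb ⟩
  d * (c * b)   ≡⟨ *-assoc d c b ⟨
  d * c * b     ≈⟨ *-congʳ-mod b {d * c} {1} dc≡1 ⟩
  1 * b         ≡⟨ *-identityˡ b ⟩
  b             ∎
  where open SetoidReasoning (≡-mod-setoid N)

*-Σ-mod : ∀ {N} c m {f g : Fin m → ℕ} →
          (∀ i → (c * f i) ≡ g i [mod N ]) → (c * Σ m f) ≡ Σ m g [mod N ]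
*-Σ-mod c zero    _    = ≡-mod-reflexive (*-zeroʳ c)
*-Σ-mod {N} c (suc m) {f} {g} cf≡g = begin
  c * (f zero + Σ m (f ∘ suc))          ≡⟨ *-distribˡ-+ c (f zero) _ ⟩
  c * f zero + c * Σ m (f ∘ suc)        ≈⟨ +-cong-mod {a = c * f zero} {g zero} {c * Σ m (f ∘ suc)} {Σ m (g ∘ suc)}
                                             (cf≡g zero) (*-Σ-mod c m (cf≡g ∘ suc)) ⟩
  g zero + Σ m (g ∘ suc)                ∎
  where open SetoidReasoning (≡-mod-setoid N)

F-dOcagne : ∀ a b → + F (a + b) ⊛ + F (suc a) ⊖ + F (suc (a + b)) ⊛ + F a ≡ -1ℤ ^ a ⊛ + F b
F-dOcagne zero b =
  solve 2 (λ x y → x :* con 1ℤ :- y :* con 0ℤ := con 1ℤ :* x) refl (+ F b) (+ F (suc b))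
  where open +-*-Solver
F-dOcagne (suc a) b = begin
  + F (suc (a + b)) ⊛ + (F (suc a) + F a) ⊖ + (F (suc (a + b)) + F (a + b)) ⊛ + F (suc a)
    ≡⟨ cong₂ (λ x y → + F (suc (a + b)) ⊛ x ⊖ y ⊛ + F (suc a))
             (pos-+ (F (suc a)) (F a)) (pos-+ (F (suc (a + b))) (F (a + b))) ⟩
  + F (suc (a + b)) ⊛ (+ F (suc a) ⊕ + F a) ⊖ (+ F (suc (a + b)) ⊕ + F (a + b)) ⊛ + F (suc a)
    ≡⟨ solve 4 (λ u v x y → v :* (y :+ x) :- (v :+ u) :* y := :- (u :* y :- v :* x)) refl
         (+ F (a + b)) (+ F (suc (a + b))) (+ F a) (+ F (suc a)) ⟩
  - (+ F (a + b) ⊛ + F (suc a) ⊖ + F (suc (a + b)) ⊛ + F a)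
    ≡⟨ cong -_ (F-dOcagne a b) ⟩
  - (-1ℤ ^ a ⊛ + F b)
    ≡⟨ solve 2 (λ s x → :- (s :* x) := con -1ℤ :* s :* x) refl (-1ℤ ^ a) (+ F b) ⟩
  -1ℤ ^ suc a ⊛ + F b ∎
  where open ≡-Reasoning
        open +-*-Solver

-1^even : ∀ t → -1ℤ ^ (2 * t) ≡ 1ℤ
-1^even t = trans (sym (^-*-assoc -1ℤ 2 t)) (^-zeroˡ t)

F-dOcagne-even-mod : ∀ t b → (F (2 * t + b) * F (suc (2 * t))) ≡ F b [mod F (suc (2 * t + b)) ]
F-dOcagne-even-mod t b = ∣⇒∣ᵤ (divides (+ F (2 * t)) (begin
  + (F (2 * t + b) * F (suc (2 * t))) ⊖ + F b
    ≡⟨ cong₂ _⊖_ (pos-* (F (2 * t + b)) (F (suc (2 * t)))) (sym dOcagne) ⟩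
  x ⊛ y ⊖ (x ⊛ y ⊖ N ⊛ g)
    ≡⟨ solve 4 (λ x y N g → x :* y :- (x :* y :- N :* g) := g :* N) refl x y N g ⟩
  g ⊛ N ∎))
  where
  open ≡-Reasoning
  open +-*-Solver
  x = + F (2 * t + b)
  y = + F (suc (2 * t))
  N = + F (suc (2 * t + b))
  g = + F (2 * t)
  dOcagne : x ⊛ y ⊖ N ⊛ g ≡ + F b
  dOcagne = trans (F-dOcagne (2 * t) b)
                  (trans (cong (_⊛ + F b) (-1^even t)) (ℤ.*-identityˡ (+ F b)))

2[m+n]∸2m+1≡1+2n : ∀ m n → 2 * (m + n) ∸ 2 * m + 1 ≡ suc (2 * n)
2[m+n]∸2m+1≡1+2n m n = trans (cong (λ x → x ∸ 2 * m + 1) (*-distribˡ-+ 2 m n))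
  (trans (cong (_+ 1) (m+n∸m≡n (2 * m) (2 * n))) (+-comm (2 * n) 1))

2[1+m]∸1≡1+2m : ∀ m → 2 * suc m ∸ 1 ≡ suc (2 * m)
2[1+m]∸1≡1+2m m =
  cong (_∸ 1) (solve 1 (λ m → con 2 :* (con 1 :+ m) := con 2 :+ con 2 :* m) refl m)
  where open ℕ.+-*-Solver

2[1+m+n]≡1+2m+1+2n : ∀ m n → 2 * (suc m + n) ≡ suc (2 * m + suc (2 * n))
2[1+m+n]≡1+2m+1+2n =
  solve 2 (λ m n → con 2 :* (con 1 :+ m :+ n) := con 1 :+ (con 2 :* m :+ (con 1 :+ con 2 :* n))) refl
  where open ℕ.+-*-Solver

F-*-mod-reindex : ∀ {x y z w x′ y′ z′ w′} → x ≡ x′ → y ≡ y′ → z ≡ z′ → w ≡ w′ →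
  (F x * F y) ≡ F z [mod F w ] → (F x′ * F y′) ≡ F z′ [mod F w′ ]
F-*-mod-reindex refl refl refl refl h = h

F-odd-*-mod : ∀ {n k} → 1 ≤ k → k ≤ n →
              (F (2 * n ∸ 1) * F (2 * k ∸ 1)) ≡ F (2 * n ∸ 2 * k + 1) [mod F (2 * n) ]
F-odd-*-mod {k = suc t} (s≤s z≤n) k≤n with m≤n⇒∃[o]m+o≡n k≤n
... | j , refl = F-*-mod-reindex
  (cong (_∸ 1) (sym (2[1+m+n]≡1+2m+1+2n t j)))
  (sym (2[1+m]∸1≡1+2m t))
  (sym (2[m+n]∸2m+1≡1+2n (suc t) j))
  (sym (2[1+m+n]≡1+2m+1+2n t j))
  (F-dOcagne-even-mod t (suc (2 * j)))

theorem1p3 : (n m : ℕ) → 1 ≤ n → 1 ≤ m →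
    (k k′ : Fin m → ℕ) →
    (∀ i → 1 ≤ k i × k i ≤ n) → (∀ i → 1 ≤ k′ i × k′ i ≤ n) →
    (Σ m (λ i → F (2 * k i ∸ 1)) ≡ Σ m (λ i → F (2 * k′ i ∸ 1)) [mod F (2 * n) ])
      ⇔ (Σ m (λ i → F (2 * n ∸ 2 * k i + 1)) ≡ Σ m (λ i → F (2 * n ∸ 2 * k′ i + 1)) [mod F (2 * n) ])
theorem1p3 n m 1≤n _ k k′ k-range k′-range = mk⇔ forward backward
  where
  open SetoidReasoning (≡-mod-setoid (F (2 * n)))
  c = F (2 * n ∸ 1)
  image : ∀ {κ} → (∀ i → 1 ≤ κ i × κ i ≤ n) →
    (c * Σ m (λ i → F (2 * κ i ∸ 1))) ≡ Σ m (λ i → F (2 * n ∸ 2 * κ i + 1)) [mod F (2 * n) ]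
  image {κ} κ-range =
    *-Σ-mod c m (λ i → F-odd-*-mod {n} {κ i} (proj₁ (κ-range i)) (proj₂ (κ-range i)))
  cassini : (c * c) ≡ 1 [mod F (2 * n) ]
  cassini = subst (λ x → (c * c) ≡ F (x + 1) [mod F (2 * n) ]) (n∸n≡0 (2 * n))
                  (F-odd-*-mod {n} {n} 1≤n ≤-refl)
  S = Σ m (λ i → F (2 * k i ∸ 1))
  T = Σ m (λ i → F (2 * k′ i ∸ 1))
  S′ = Σ m (λ i → F (2 * n ∸ 2 * k i + 1))
  T′ = Σ m (λ i → F (2 * n ∸ 2 * k′ i + 1))
  forward : S ≡ T [mod F (2 * n) ] → S′ ≡ T′ [mod F (2 * n) ]
  forward S≡T = begin
    S′      ≈⟨ image {k} k-range ⟨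
    c * S   ≈⟨ *-congˡ-mod c {S} {T} S≡T ⟩
    c * T   ≈⟨ image {k′} k′-range ⟩
    T′      ∎
  backward : S′ ≡ T′ [mod F (2 * n) ] → S ≡ T [mod F (2 * n) ]
  backward S′≡T′ = *-cancelˡ-mod {c = c} {c} {S} {T} cassini (begin
    c * S   ≈⟨ image {k} k-range ⟩
    S′      ≈⟨ S′≡T′ ⟩
    T′      ≈⟨ image {k′} k′-range ⟨
    c * T   ∎)
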